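{- For all integers $i\ge7$ and $n\ge16$, $A_i(n)\le f_{i+7}(n)$.
   Context: For a function $f:\mathbb N\to\mathbb N$, $f^{(0)}(x)=x$ and $f^{(n+1)}(x)=f(f^{(n)}(x))$. Define $f_i:\mathbb N\to\mathbb N$ for $i\ge1$ by $f_1(n)=n+1$ and $f_{i+1}(n)=f_i^{(\lfloor\sqrt n/2\rfloor)}(n)$. Define $A_i:\mathbb N\to\mathbb N$ for $i\ge1$ by $A_1(n)=n+1$ and $A_{i+1}(n)=A_i^{(n)}(n)$. -}

module Defs where

open import Data.Nat using (ℕ; zero; suc; _+_; _*_; _≤?_; _/_)
open import Relation.Nullary.Decidable using (does)
open import Data.Bool using (if_then_else_)

iter : (ℕ → ℕ) → ℕ → ℕ → ℕ
iter f zero    x = x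
iter f (suc k) x = f (iter f k x)

-- integer square root: ⌊√n⌋ = the largest r with r * r ≤ n
-- (computed incrementally: ⌊√(n+1)⌋ is ⌊√n⌋ or ⌊√n⌋ + 1)
isqrt : ℕ → ℕ
isqrt zero = zero
isqrt (suc n) with isqrt n
... | r = if does (suc r * suc r ≤? suc n) then suc r else r

-- ⌊ √n / 2 ⌋ = ⌊ ⌊√n⌋ / 2 ⌋
halfSqrt : ℕ → ℕ
halfSqrt n = isqrt n / 2

-- f i n with the paper's index shifted: fAux k = f_(k+1)
fAux : ℕ → ℕ → ℕ
fAux zero    n = suc n
fAux (suc k) n = iter (fAux k) (halfSqrt n) n

-- A i n similarly: AAux k = A_(k+1)
AAux : ℕ → ℕ → ℕ
AAux zero    n = suc n
AAux (suc k) n = iter (AAux k) n n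

-- paper-indexed versions (index i ≥ 1; the value at i = 0 is an unused convention)
f : ℕ → ℕ → ℕ
f zero    = fAux zero
f (suc k) = fAux k

A : ℕ → ℕ → ℕ
A zero    = AAux zero
A (suc k) = AAux k

{-# OPTIONS --safe #-}
-- Write h = halfSqrt, so h x ≥ 2 once x ≥ 16 and therefore fAux k ∘ fAux k ≤ fAux (suc k).
-- Since fAux 2 x ≥ x + (h x)² ≥ 10x/9 and a lower ratio squares from one level to the next,
-- fAux 6 x ≥ 4x; iterating gives fAux 7 y ≥ 4^(h y) · y, and then fAux 8 y ≥ (4y)².
-- That quadratic bound makes h (fAux (k + 8) n) ≥ 2n, enough room to push the invariant
-- AAux (suc k) ≤ fAux (k + 7) ∘ fAux (k + 7) from k to suc k; one more composition
-- gives A i ≤ f (i + 7).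
module Submission where

open import Defs
open import Data.Nat using (ℕ; zero; suc; _+_; _*_; _^_; _∸_; _≤_; _<_; z≤n; s≤s; _≤?_; _/_; _%_; _<ᵇ_)
open import Data.Nat.Properties
open import Data.Nat.DivMod using (m≡m%n+[m/n]*n; m%n<n; m*n/n≡m; /-monoˡ-≤)
open import Data.Nat.Tactic.RingSolver using (solve-∀)
open import Data.Bool using (true; false)
open import Data.Sum using (inj₁; inj₂)
open import Data.Product using (_×_; _,_; proj₁; proj₂)
open import Data.Unit using (tt)
open import Function using (_∘_)
open import Relation.Binary.Core using (_Preserves_⟶_)
open import Relation.Binary.PropositionalEquality using (_≡_; refl; cong; module ≡-Reasoning)
open import Relation.Nullary using (yes; no; ofʸ; ofⁿ)
open import Relation.Nullary.Negation using (contradiction)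

Inflationary : (ℕ → ℕ) → Set
Inflationary F = ∀ x → x ≤ F x

module _ {F : ℕ → ℕ} where

  iter-+ : ∀ d j x → iter F (d + j) x ≡ iter F d (iter F j x)
  iter-+ zero    j x = refl
  iter-+ (suc d) j x = cong F (iter-+ d j x)

  iter-inflationary : Inflationary F → ∀ k → Inflationary (iter F k)
  iter-inflationary F-infl zero    x = ≤-refl
  iter-inflationary F-infl (suc k) x = ≤-trans (iter-inflationary F-infl k x) (F-infl _)

  iter-mono-≤ : F Preserves _≤_ ⟶ _≤_ → ∀ k → iter F k Preserves _≤_ ⟶ _≤_
  iter-mono-≤ F-mono zero    x≤y = x≤y
  iter-mono-≤ F-mono (suc k) x≤y = F-mono (iter-mono-≤ F-mono k x≤y)

  iter-monoˡ-≤ : Inflationary F → ∀ {j k} x → j ≤ k → iter F j x ≤ iter F k x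
  iter-monoˡ-≤ F-infl {j} {k} x j≤k = begin
    iter F j x                    ≤⟨ iter-inflationary F-infl (k ∸ j) _ ⟩
    iter F (k ∸ j) (iter F j x)   ≡⟨ iter-+ (k ∸ j) j x ⟨
    iter F (k ∸ j + j) x          ≡⟨ cong (λ t → iter F t x) (m∸n+n≡m j≤k) ⟩
    iter F k x                    ∎
    where open ≤-Reasoning

  iter-square : ∀ m x → iter (F ∘ F) m x ≡ iter F (m + m) x
  iter-square zero    x = refl
  iter-square (suc m) x = begin
    F (F (iter (F ∘ F) m x))     ≡⟨ cong (F ∘ F) (iter-square m x) ⟩
    F (F (iter F (m + m) x))     ≡⟨ cong (λ t → F (iter F t x)) (+-suc m m) ⟨
    F (iter F (m + suc m) x)     ∎
    where open ≡-Reasoning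

  ^*≤iter : ∀ {c t} → Inflationary F → (∀ x → t ≤ x → c * x ≤ F x) →
            ∀ k x → t ≤ x → c ^ k * x ≤ iter F k x
  ^*≤iter F-infl cx≤Fx zero    x t≤x = ≤-reflexive (+-identityʳ x)
  ^*≤iter {c} F-infl cx≤Fx (suc k) x t≤x = begin
    c * c ^ k * x         ≡⟨ *-assoc c (c ^ k) x ⟩
    c * (c ^ k * x)       ≤⟨ *-monoʳ-≤ c (^*≤iter F-infl cx≤Fx k x t≤x) ⟩
    c * iter F k x        ≤⟨ cx≤Fx _ (≤-trans t≤x (iter-inflationary F-infl k x)) ⟩
    F (iter F k x)        ∎
    where open ≤-Reasoning

iter-≤-iter : ∀ {F G t} → F Preserves _≤_ ⟶ _≤_ → Inflationary G → (∀ x → t ≤ x → G x ≤ F x) →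
              ∀ m x → t ≤ x → iter G m x ≤ iter F m x
iter-≤-iter F-mono G-infl G≤F zero    x t≤x = ≤-refl
iter-≤-iter F-mono G-infl G≤F (suc m) x t≤x =
  ≤-trans (G≤F _ (≤-trans t≤x (iter-inflationary G-infl m x)))
          (F-mono (iter-≤-iter F-mono G-infl G≤F m x t≤x))

iter-suc : ∀ k x → iter suc k x ≡ k + x
iter-suc zero    x = refl
iter-suc (suc k) x = cong suc (iter-suc k x)

n<m^n : ∀ {m} n → 1 < m → n < m ^ n
n<m^n zero    1<m = s≤s z≤n
n<m^n (suc n) 1<m = ≤-<-trans (n<m^n n 1<m) (^-monoʳ-< _ 1<m (n<1+n n))

isqrt-bounds : ∀ n → isqrt n * isqrt n ≤ n × n < suc (isqrt n) * suc (isqrt n)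
isqrt-bounds zero = z≤n , s≤s z≤n
isqrt-bounds (suc n) with isqrt n | isqrt-bounds n
... | r | r²≤n , n<[1+r]²
  -- the guard  does (suc r * suc r ≤? suc n)  of isqrt (suc n) normalises to this test
  with r + r * suc r <ᵇ suc n | <ᵇ-reflects-< (r + r * suc r) (suc n)
... | true  | ofʸ [1+r]²≤1+n =
  [1+r]²≤1+n , <-≤-trans (s≤s n<[1+r]²) (*-mono-< (n<1+n (suc r)) (n<1+n (suc r)))
... | false | ofⁿ [1+r]²≰1+n = m≤n⇒m≤1+n r²≤n , ≰⇒> [1+r]²≰1+n

r*r≤n⇒r≤isqrt : ∀ {r n} → r * r ≤ n → r ≤ isqrt n
r*r≤n⇒r≤isqrt {r} {n} r²≤n with r ≤? isqrt n
... | yes r≤s = r≤s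
... | no  r≰s = contradiction (≤-trans (*-mono-≤ (≰⇒> r≰s) (≰⇒> r≰s)) r²≤n) (<⇒≱ (proj₂ (isqrt-bounds n)))

isqrt-mono-≤ : isqrt Preserves _≤_ ⟶ _≤_
isqrt-mono-≤ {m} m≤n = r*r≤n⇒r≤isqrt (≤-trans (proj₁ (isqrt-bounds m)) m≤n)

halfSqrt-mono-≤ : halfSqrt Preserves _≤_ ⟶ _≤_
halfSqrt-mono-≤ = /-monoˡ-≤ 2 ∘ isqrt-mono-≤

[4k]²≤n⇒k+k≤halfSqrt : ∀ {k n} → (4 * k) * (4 * k) ≤ n → k + k ≤ halfSqrt n
[4k]²≤n⇒k+k≤halfSqrt {k} {n} [4k]²≤n = begin
  k + k            ≡⟨ m*n/n≡m (k + k) 2 ⟨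
  (k + k) * 2 / 2  ≡⟨ cong (_/ 2) ([k+k]*2≡4k k) ⟩
  4 * k / 2        ≤⟨ /-monoˡ-≤ 2 (r*r≤n⇒r≤isqrt {4 * k} [4k]²≤n) ⟩
  isqrt n / 2      ∎
  where
  open ≤-Reasoning
  [k+k]*2≡4k : ∀ k → (k + k) * 2 ≡ 4 * k
  [k+k]*2≡4k = solve-∀

16≤⇒2≤halfSqrt : ∀ {n} → 16 ≤ n → 2 ≤ halfSqrt n
16≤⇒2≤halfSqrt = [4k]²≤n⇒k+k≤halfSqrt {1}

isqrt<2*halfSqrt+2 : ∀ n → isqrt n < 2 * halfSqrt n + 2
isqrt<2*halfSqrt+2 n = begin-strict
  s                  ≡⟨ m≡m%n+[m/n]*n s 2 ⟩
  s % 2 + s / 2 * 2  <⟨ +-monoˡ-< (s / 2 * 2) (m%n<n s 2) ⟩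
  2 + s / 2 * 2      ≡⟨ +-comm 2 (s / 2 * 2) ⟩
  s / 2 * 2 + 2      ≡⟨ cong (_+ 2) (*-comm (s / 2) 2) ⟩
  2 * (s / 2) + 2    ∎
  where
  open ≤-Reasoning
  s = isqrt n

16≤⇒≤9*halfSqrt² : ∀ {n} → 16 ≤ n → n ≤ 9 * (halfSqrt n * halfSqrt n)
16≤⇒≤9*halfSqrt² {n} 16≤n = begin
  n                    <⟨ proj₂ (isqrt-bounds n) ⟩
  suc s * suc s        ≤⟨ *-mono-≤ 1+s≤3h 1+s≤3h ⟩
  (3 * h) * (3 * h)    ≡⟨ [3h]²≡9h² h ⟩
  9 * (h * h)          ∎
  where
  open ≤-Reasoning
  s = isqrt n
  h = halfSqrt n
  1+s≤3h : suc s ≤ 3 * h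
  1+s≤3h = ≤-trans (isqrt<2*halfSqrt+2 n) (≤-trans (+-monoʳ-≤ (2 * h) (16≤⇒2≤halfSqrt 16≤n))
             (≤-reflexive (2h+h≡3h h)))
    where
    2h+h≡3h : ∀ h → 2 * h + h ≡ 3 * h
    2h+h≡3h = solve-∀
  [3h]²≡9h² : ∀ h → (3 * h) * (3 * h) ≡ 9 * (h * h)
  [3h]²≡9h² = solve-∀

fAux-inflationary : ∀ k → Inflationary (fAux k)
fAux-inflationary zero    = n≤1+n
fAux-inflationary (suc k) x = iter-inflationary (fAux-inflationary k) (halfSqrt x) x

fAux-mono-≤ : ∀ k → fAux k Preserves _≤_ ⟶ _≤_
fAux-mono-≤ zero    x≤y = s≤s x≤y
fAux-mono-≤ (suc k) {x} {y} x≤y = begin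
  iter (fAux k) (halfSqrt x) x   ≤⟨ iter-mono-≤ (fAux-mono-≤ k) (halfSqrt x) x≤y ⟩
  iter (fAux k) (halfSqrt x) y   ≤⟨ iter-monoˡ-≤ (fAux-inflationary k) y (halfSqrt-mono-≤ x≤y) ⟩
  iter (fAux k) (halfSqrt y) y   ∎
  where open ≤-Reasoning

fAux∘fAux≤fAux-suc : ∀ k {x} → 16 ≤ x → fAux k (fAux k x) ≤ fAux (suc k) x
fAux∘fAux≤fAux-suc k {x} 16≤x = iter-monoˡ-≤ (fAux-inflationary k) x (16≤⇒2≤halfSqrt 16≤x)

fAux≤fAux-suc : ∀ k {x} → 16 ≤ x → fAux k x ≤ fAux (suc k) x
fAux≤fAux-suc k 16≤x = ≤-trans (fAux-inflationary k _) (fAux∘fAux≤fAux-suc k 16≤x)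

fAux-monoˡ-≤ : ∀ {j k x} → j ≤ k → 16 ≤ x → fAux j x ≤ fAux k x
fAux-monoˡ-≤ {k = zero}  z≤n 16≤x = ≤-refl
fAux-monoˡ-≤ {j} {suc k} j≤1+k 16≤x with m≤n⇒m<n∨m≡n j≤1+k
... | inj₁ (s≤s j≤k) = ≤-trans (fAux-monoˡ-≤ j≤k 16≤x) (fAux≤fAux-suc k 16≤x)
... | inj₂ refl      = ≤-refl

iter-fAux1-≥ : ∀ k x → x + k * halfSqrt x ≤ iter (fAux 1) k x
iter-fAux1-≥ zero    x = ≤-reflexive (+-identityʳ x)
iter-fAux1-≥ (suc k) x = begin
  x + (h + k * h)          ≡⟨ x+[h+kh]≡h+[x+kh] x h k ⟩
  h + (x + k * h)          ≤⟨ +-mono-≤ (halfSqrt-mono-≤ (iter-inflationary (fAux-inflationary 1) k x))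
                                      (iter-fAux1-≥ k x) ⟩
  halfSqrt y + y           ≡⟨ iter-suc (halfSqrt y) y ⟨
  fAux 1 y                 ∎
  where
  open ≤-Reasoning
  h = halfSqrt x
  y = iter (fAux 1) k x
  x+[h+kh]≡h+[x+kh] : ∀ x h k → x + (h + k * h) ≡ h + (x + k * h)
  x+[h+kh]≡h+[x+kh] = solve-∀

10x≤9*fAux2 : ∀ x → 16 ≤ x → 10 * x ≤ 9 * fAux 2 x
10x≤9*fAux2 x 16≤x = begin
  10 * x                    ≡⟨ 10x≡9x+x x ⟩
  9 * x + x                 ≤⟨ +-monoʳ-≤ (9 * x) (16≤⇒≤9*halfSqrt² 16≤x) ⟩
  9 * x + 9 * (h * h)       ≡⟨ *-distribˡ-+ 9 x (h * h) ⟨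
  9 * (x + h * h)           ≤⟨ *-monoʳ-≤ 9 (iter-fAux1-≥ h x) ⟩
  9 * fAux 2 x              ∎
  where
  open ≤-Reasoning
  h = halfSqrt x
  10x≡9x+x : ∀ x → 10 * x ≡ 9 * x + x
  10x≡9x+x = solve-∀

bx≤a*fAux⇒b²x≤a²*fAux-suc : ∀ {a b k} → (∀ x → 16 ≤ x → b * x ≤ a * fAux k x) →
                             ∀ x → 16 ≤ x → (b * b) * x ≤ (a * a) * fAux (suc k) x
bx≤a*fAux⇒b²x≤a²*fAux-suc {a} {b} {k} bx≤aFx x 16≤x = begin
  b * b * x               ≡⟨ *-assoc b b x ⟩
  b * (b * x)             ≤⟨ *-monoʳ-≤ b (bx≤aFx x 16≤x) ⟩
  b * (a * y)             ≡⟨ x*[y*z]≡y*[x*z] b a y ⟩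
  a * (b * y)             ≤⟨ *-monoʳ-≤ a (bx≤aFx y (≤-trans 16≤x (fAux-inflationary k x))) ⟩
  a * (a * fAux k y)      ≡⟨ *-assoc a a (fAux k y) ⟨
  a * a * fAux k y        ≤⟨ *-monoʳ-≤ (a * a) (fAux∘fAux≤fAux-suc k 16≤x) ⟩
  a * a * fAux (suc k) x  ∎
  where
  open ≤-Reasoning
  y = fAux k x
  x*[y*z]≡y*[x*z] : ∀ x y z → x * (y * z) ≡ y * (x * z)
  x*[y*z]≡y*[x*z] = solve-∀

4x≤fAux6 : ∀ x → 16 ≤ x → 4 * x ≤ fAux 6 x
4x≤fAux6 x 16≤x = *-cancelˡ-≤ (9 ^ 16) (begin
  9 ^ 16 * (4 * x)     ≡⟨ *-assoc (9 ^ 16) 4 x ⟨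
  9 ^ 16 * 4 * x       ≤⟨ *-monoˡ-≤ x (≤ᵇ⇒≤ (9 ^ 16 * 4) (10 ^ 16) tt) ⟩
  10 ^ 16 * x          ≤⟨ [10/9]¹⁶ x 16≤x ⟩
  9 ^ 16 * fAux 6 x    ∎)
  where
  open ≤-Reasoning
  [10/9]¹⁶ : ∀ x → 16 ≤ x → 10 ^ 16 * x ≤ 9 ^ 16 * fAux 6 x
  [10/9]¹⁶ = bx≤a*fAux⇒b²x≤a²*fAux-suc {9 ^ 8} {10 ^ 8} {5}
             (bx≤a*fAux⇒b²x≤a²*fAux-suc {9 ^ 4} {10 ^ 4} {4}
             (bx≤a*fAux⇒b²x≤a²*fAux-suc {9 ^ 2} {10 ^ 2} {3}
             (bx≤a*fAux⇒b²x≤a²*fAux-suc {9} {10} {2} 10x≤9*fAux2)))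

4^halfSqrt*≤fAux7 : ∀ y → 16 ≤ y → 4 ^ halfSqrt y * y ≤ fAux 7 y
4^halfSqrt*≤fAux7 y 16≤y = ^*≤iter (fAux-inflationary 6) 4x≤fAux6 (halfSqrt y) y 16≤y

[4y]²≤fAux8 : ∀ y → 16 ≤ y → (4 * y) * (4 * y) ≤ fAux 8 y
[4y]²≤fAux8 y 16≤y = begin
  (4 * y) * (4 * y)     ≡⟨ [4y]²≡y*16y y ⟩
  y * (16 * y)          ≤⟨ *-mono-≤ y≤4^hz 16y≤z ⟩
  4 ^ halfSqrt z * z    ≤⟨ 4^halfSqrt*≤fAux7 z (≤-trans 16≤y (fAux-inflationary 7 y)) ⟩
  fAux 7 z              ≤⟨ fAux∘fAux≤fAux-suc 7 16≤y ⟩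
  fAux 8 y              ∎
  where
  open ≤-Reasoning
  [4y]²≡y*16y : ∀ y → (4 * y) * (4 * y) ≡ y * (16 * y)
  [4y]²≡y*16y = solve-∀
  [4y]²≡16y² : ∀ y → (4 * y) * (4 * y) ≡ 16 * (y * y)
  [4y]²≡16y² = solve-∀
  s = isqrt y
  z = fAux 7 y
  16y≤z : 16 * y ≤ z
  16y≤z = ≤-trans (*-monoˡ-≤ y (^-monoʳ-≤ 4 (16≤⇒2≤halfSqrt 16≤y))) (4^halfSqrt*≤fAux7 y 16≤y)
  [4s]²≤z : (4 * s) * (4 * s) ≤ z
  [4s]²≤z = ≤-trans (≤-reflexive ([4y]²≡16y² s)) (≤-trans (*-monoʳ-≤ 16 (proj₁ (isqrt-bounds y))) 16y≤z)
  y≤4^hz : y ≤ 4 ^ halfSqrt z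
  y≤4^hz = <⇒≤ (begin-strict
    y                  <⟨ proj₂ (isqrt-bounds y) ⟩
    suc s * suc s      ≤⟨ *-mono-≤ (n<m^n s 1<4) (n<m^n s 1<4) ⟩
    4 ^ s * 4 ^ s      ≡⟨ ^-distribˡ-+-* 4 s s ⟨
    4 ^ (s + s)        ≤⟨ ^-monoʳ-≤ 4 ([4k]²≤n⇒k+k≤halfSqrt {s} [4s]²≤z) ⟩
    4 ^ halfSqrt z     ∎)
    where
    1<4 : 1 < 4
    1<4 = s≤s (s≤s z≤n)

n+n≤halfSqrt∘fAux : ∀ {m n} → 8 ≤ m → 16 ≤ n → n + n ≤ halfSqrt (fAux m n)
n+n≤halfSqrt∘fAux {n = n} 8≤m 16≤n =
  [4k]²≤n⇒k+k≤halfSqrt {n} (≤-trans ([4y]²≤fAux8 n 16≤n) (fAux-monoˡ-≤ 8≤m 16≤n))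

AAux-inflationary : ∀ k → Inflationary (AAux k)
AAux-inflationary zero      = n≤1+n
AAux-inflationary (suc k) x = iter-inflationary (AAux-inflationary k) x x

AAux1≤fAux7∘fAux7 : ∀ {n} → 16 ≤ n → AAux 1 n ≤ fAux 7 (fAux 7 n)
AAux1≤fAux7∘fAux7 {n} 16≤n = begin
  iter suc n n           ≡⟨ iter-suc n n ⟩
  n + n                  ≤⟨ +-monoʳ-≤ n (m≤m+n n _) ⟩
  4 * n                  ≤⟨ 4x≤fAux6 n 16≤n ⟩
  fAux 6 n               ≤⟨ fAux≤fAux-suc 6 16≤n ⟩
  fAux 7 n               ≤⟨ fAux-inflationary 7 _ ⟩
  fAux 7 (fAux 7 n)      ∎
  where open ≤-Reasoning

-- Iterating the bound n times costs 2n steps of F = fAux (k + 7); for G = fAux (k + 8)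
-- they fit into the halfSqrt (G n) ≥ 2n steps of F that make up G (G n).
AAux-suc≤fAux∘fAux : ∀ k {n} → 16 ≤ n → AAux (suc k) n ≤ fAux (k + 7) (fAux (k + 7) n)
AAux-suc≤fAux∘fAux zero    16≤n = AAux1≤fAux7∘fAux7 16≤n
AAux-suc≤fAux∘fAux (suc k) {n} 16≤n = begin
  iter (AAux (suc k)) n n      ≤⟨ iter-≤-iter (F-mono ∘ F-mono) (AAux-inflationary (suc k))
                                    (λ _ → AAux-suc≤fAux∘fAux k) n n 16≤n ⟩
  iter (F ∘ F) n n             ≡⟨ iter-square n n ⟩
  iter F (n + n) n             ≤⟨ iter-mono-≤ F-mono (n + n) (fAux-inflationary (suc (k + 7)) n) ⟩
  iter F (n + n) (G n)         ≤⟨ iter-monoˡ-≤ (fAux-inflationary (k + 7)) (G n)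
                                    (n+n≤halfSqrt∘fAux (s≤s (m≤n+m 7 k)) 16≤n) ⟩
  iter F (halfSqrt (G n)) (G n) ∎
  where
  open ≤-Reasoning
  F = fAux (k + 7)
  G = fAux (suc (k + 7))
  F-mono : F Preserves _≤_ ⟶ _≤_
  F-mono = fAux-mono-≤ (k + 7)

mainTheorem6 : ∀ (i n : ℕ) → 7 ≤ i → 16 ≤ n → A i n ≤ f (i + 7) n
-- 7 ≤ i only excludes i ≤ 1: the argument works for every i ≥ 2.
mainTheorem6 zero          n ()              _
mainTheorem6 (suc zero)    n (s≤s ())        _
mainTheorem6 (suc (suc k)) n _ 16≤n =
  ≤-trans (AAux-suc≤fAux∘fAux k 16≤n) (fAux∘fAux≤fAux-suc (k + 7) 16≤n)
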